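{- If $p\geq 2$ is an integer and $T$ is a tree with maximum degree $\Delta$, then $\sigma_{(p,q)}(T)=\sigma_{(p,1)}(T)$ for every $q\in\mathbb{N}\cup\{\infty\}$. In particular, $\sigma_{(p,\infty)}(T)=\sigma_{(p,\Delta)}(T)=\sigma_{(p,1)}(T)$.
   Context: Vertices are colored white or blue. Spreading color change rule with parameters $p\in\mathbb{N}$, $q\in\mathbb{N}\cup\{\infty\}$: if a white vertex $w$ has at least $p$ blue neighbors, and one of the blue neighbors of $w$ has at most $q$ white neighbors, then $w$ is recolored blue ($q=\infty$ imposes no restriction). A set $S$ is a $(p,q)$-spreading set if, when exactly the vertices of $S$ are initially blue, repeated application of this rule eventually makes all vertices blue; $\sigma_{(p,q)}(G)$ is the minimum size of a $(p,q)$-spreading set of $G$. -}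

module Defs where

open import Data.Nat using (ℕ; zero; suc; _≤_; _⊔_)
open import Data.Bool using (Bool; true; false)
open import Data.Fin using (Fin)
open import Data.Fin.Subset using (Subset; _∈_; _∉_; _∩_; _∪_; ∁; ⁅_⁆; ∣_∣)
  renaming (⊤ to full)
open import Data.Vec using (tabulate)
open import Data.List using (List; []; _∷_; length; map; foldr; allFin)
open import Data.List.Relation.Unary.Unique.Propositional using (Unique)
open import Data.Maybe using (Maybe; just; nothing)
open import Data.Product using (Σ; ∃; _×_)
open import Data.Empty using (⊥)
open import Data.Unit using (⊤)
open import Relation.Nullary using (¬_)
open import Relation.Binary.PropositionalEquality using (_≡_)
open import Relation.Binary.Construct.Closure.ReflexiveTransitive using (Star)

record Graph (n : ℕ) : Set where
  field
    adj     : Fin n → Fin n → Bool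
    adj-sym : ∀ u v → adj u v ≡ adj v u
    irrefl  : ∀ v → adj v v ≡ false
open Graph public

module _ {n : ℕ} (G : Graph n) where

  Adj : Fin n → Fin n → Set
  Adj u v = adj G u v ≡ true

  N : Fin n → Subset n
  N v = tabulate (adj G v)

  degree : Fin n → ℕ
  degree v = ∣ N v ∣

  maxDegree : ℕ
  maxDegree = foldr _⊔_ 0 (map degree (allFin n))

  data Walk : Fin n → Fin n → Set where
    here : ∀ {u} → Walk u u
    step : ∀ {u v w} → Adj u v → Walk v w → Walk u w

  Connected : Set
  Connected = ∀ u v → Walk u v

  Chain : List (Fin n) → Set
  Chain [] = ⊤
  Chain (x ∷ []) = ⊤
  Chain (x ∷ y ∷ xs) = Adj x y × Chain (y ∷ xs)

  lastOf : Fin n → List (Fin n) → Fin n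
  lastOf x [] = x
  lastOf x (y ∷ ys) = lastOf y ys

  HasCycle : Set
  HasCycle = Σ (Fin n) λ x → Σ (List (Fin n)) λ xs →
    Unique (x ∷ xs) × 2 ≤ length xs × Chain (x ∷ xs) × Adj (lastOf x xs) x

  IsTree : Set
  IsTree = 1 ≤ n × Connected × ¬ HasCycle

  -- q ∈ ℕ ∪ {∞}, with nothing = ∞
  WithinQ : Maybe ℕ → ℕ → Set
  WithinQ nothing  k = ⊤
  WithinQ (just q) k = k ≤ q

  -- one application of the (p,q)-spreading colour change rule to the blue set B
  Step : ℕ → Maybe ℕ → Subset n → Subset n → Set
  Step p q B B' = Σ (Fin n) λ w →
    w ∉ B × p ≤ ∣ N w ∩ B ∣ ×
    (Σ (Fin n) λ u → u ∈ B × Adj w u × WithinQ q ∣ N u ∩ ∁ B ∣) ×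
    B' ≡ B ∪ ⁅ w ⁆

  Spreading : ℕ → Maybe ℕ → Subset n → Set
  Spreading p q S = Star (Step p q) S full

  IsSigma : ℕ → Maybe ℕ → ℕ → Set
  IsSigma p q k = (Σ (Subset n) λ S → Spreading p q S × ∣ S ∣ ≡ k)
                × (∀ S → Spreading p q S → k ≤ ∣ S ∣)

{-# OPTIONS --safe #-}
-- In a forest with p ≥ 2, every set that spreads under some (p,q)-rule already spreads
-- under the most restrictive rule q = 1; the converse inclusions are immediate, since the
-- rule only gets weaker as q grows and q ≥ Δ is no restriction at all.  To see the claim,
-- run the (p,1)-process greedily.  Suppose it gets stuck while some vertex is still white.
-- Record when each vertex turned blue in the original process: then every white vertex has
-- p ≥ 2 neighbours that turned blue before it, and stuckness says that every blue neighbour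
-- of a white vertex with p blue neighbours has at least two white neighbours.  From a white
-- vertex one can always move to an earlier neighbour other than the one we came from (to a
-- white one if possible), and from such a blue vertex to a white neighbour other than the
-- one we came from; this endless non-backtracking walk forces a cycle.
module Submission where

open import Defs
open import Data.Nat using (ℕ; _≤_)
open import Data.Maybe using (Maybe; just; nothing)
open import Data.Product using (_×_)
open import Function.Bundles using (_⇔_)

open import Data.Nat using (zero; suc; _<_; _+_; _⊔_; _<ᵇ_; _≤?_; z≤n; s≤s)
open import Data.Nat.Properties
  using (≤-refl; ≤-trans; ≤-reflexive; <-irrefl; <-asym; <⇒≱; ≰⇒>; +-suc; m<m+n;
         m≤m⊔n; m≤n⇒m≤o⊔n; <⇒<ᵇ; <ᵇ⇒<)
open import Data.Bool using (true)
open import Data.Bool.Properties using (T-≡) renaming (_≟_ to _≟ᵇ_)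
open import Data.Fin using (Fin; zero; suc; toℕ; _≟_)
import Data.Fin.Properties as Fin
open import Data.Fin.Subset using (Subset; _∈_; _∉_; _∩_; _∪_; ∁; ⁅_⁆; ∣_∣; _⊆_; _⊂_; _⊃_)
  renaming (⊤ to full)
open import Data.Fin.Subset.Properties
  using (_∈?_; ∈⊤; ⊆⊤; ⊆-antisym; p⊆q⇒∣p∣≤∣q∣; ∣⁅x⁆∣≡1; x∈⁅x⁆; x∈⁅y⁆⇒x≡y; x∈∁p⇒x∉p;
         x∈p∩q⁺; x∈p∩q⁻; x∈p∪q⁺; x∈p∪q⁻; p⊆p∪q; ∣p∩q∣≤∣p∣)
open import Data.Fin.Subset.Induction using (Acc; acc; ⊃-wellFounded)
open import Data.Vec using (tabulate)
open import Data.Vec.Properties using (lookup∘tabulate; []=⇒lookup; lookup⇒[]=)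
open import Data.List using (List; []; _∷_; length; lookup; take; foldr)
open import Data.List.Relation.Unary.Any as Any using (here; there; index)
open import Data.List.Relation.Unary.All as All using ([]; _∷_)
open import Data.List.Relation.Unary.All.Properties.Core using (¬Any⇒All¬)
open import Data.List.Relation.Unary.AllPairs using ([]; _∷_)
open import Data.List.Relation.Unary.Unique.Propositional using (Unique)
open import Data.List.Relation.Unary.Unique.Propositional.Properties using (take⁺)
open import Data.List.Membership.Propositional using () renaming (_∈_ to _∈ₗ_)
open import Data.List.Membership.Propositional.Properties using (∈-lookup; ∈-map⁺; ∈-allFin)
open import Data.Product using (Σ; ∃; _,_)
open import Data.Sum using (inj₁; inj₂)
open import Data.Unit using (tt)
open import Function using (_∘_)
open import Function.Bundles using (Equivalence; mk⇔)
open import Relation.Nullary using (¬_; Dec; yes; no; contradiction)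
open import Relation.Nullary.Decidable using (_×-dec_; ¬?)
open import Relation.Binary.PropositionalEquality using (_≡_; _≢_; refl; sym; trans; subst; cong)
open import Relation.Binary.Construct.Closure.ReflexiveTransitive as Star using (Star; ε; _◅_)

lookup-injective : ∀ {A : Set} {xs : List A} → Unique xs →
                   ∀ {i j} → lookup xs i ≡ lookup xs j → i ≡ j
lookup-injective (_  ∷ _) {zero}  {zero}  _  = refl
lookup-injective (x∉ ∷ _) {zero}  {suc j} eq = contradiction eq (All.lookup x∉ (∈-lookup j))
lookup-injective (x∉ ∷ _) {suc i} {zero}  eq = contradiction (sym eq) (All.lookup x∉ (∈-lookup i))
lookup-injective (_  ∷ u) {suc i} {suc j} eq = cong suc (lookup-injective u eq)

length≤-Unique : ∀ {n} {xs : List (Fin n)} → Unique xs → length xs ≤ n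
length≤-Unique u = Fin.injective⇒≤ (lookup-injective u)

∈-tabulate⁺ : ∀ {n} (f : Fin n → _) {x} → f x ≡ true → x ∈ tabulate f
∈-tabulate⁺ f {x} fx = lookup⇒[]= x (tabulate f) (trans (lookup∘tabulate f x) fx)

∈-tabulate⁻ : ∀ {n} (f : Fin n → _) {x} → x ∈ tabulate f → f x ≡ true
∈-tabulate⁻ f {x} x∈ = trans (sym (lookup∘tabulate f x)) ([]=⇒lookup x∈)

2≤∣A∣⇒∃∈≢ : ∀ {n} {A : Subset n} → 2 ≤ ∣ A ∣ → ∀ y → ∃ λ x → x ∈ A × x ≢ y
2≤∣A∣⇒∃∈≢ {A = A} 2≤∣A∣ y with Fin.any? (λ x → x ∈? A ×-dec ¬? (x ≟ y))
... | yes found = found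
... | no none   = contradiction 2≤1 λ { (s≤s ()) }
  where
  A⊆⁅y⁆ : A ⊆ ⁅ y ⁆
  A⊆⁅y⁆ {x} x∈A with x ≟ y
  ... | yes refl = x∈⁅x⁆ x
  ... | no x≢y   = contradiction (x , x∈A , x≢y) none
  2≤1 : 2 ≤ 1
  2≤1 = ≤-trans 2≤∣A∣ (≤-trans (p⊆q⇒∣p∣≤∣q∣ A⊆⁅y⁆) (≤-reflexive (∣⁅x⁆∣≡1 y)))

∣∩∣-monoʳ : ∀ {n} (A : Subset n) {B C : Subset n} →
            (∀ {x} → x ∈ A → x ∈ B → x ∈ C) → ∣ A ∩ B ∣ ≤ ∣ A ∩ C ∣
∣∩∣-monoʳ A {B} B⊆C = p⊆q⇒∣p∣≤∣q∣ λ x∈A∩B →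
  let x∈A , x∈B = x∈p∩q⁻ A B x∈A∩B in x∈p∩q⁺ (x∈A , B⊆C x∈A x∈B)

B⊂B∪⁅x⁆ : ∀ {n} {B : Subset n} {x} → x ∉ B → B ⊂ B ∪ ⁅ x ⁆
B⊂B∪⁅x⁆ {x = x} x∉B = p⊆p∪q ⁅ x ⁆ , x , x∈p∪q⁺ (inj₂ (x∈⁅x⁆ x)) , x∉B

x∈xs⇒x≤foldr⊔ : ∀ {x xs} → x ∈ₗ xs → x ≤ foldr _⊔_ 0 xs
x∈xs⇒x≤foldr⊔ {xs = y ∷ ys} (here refl) = m≤m⊔n y (foldr _⊔_ 0 ys)
x∈xs⇒x≤foldr⊔ {xs = y ∷ ys} (there x∈) = m≤n⇒m≤o⊔n y (x∈xs⇒x≤foldr⊔ x∈)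

module _ {n : ℕ} (G : Graph n) where

  Adj-sym : ∀ {u v} → Adj G u v → Adj G v u
  Adj-sym {u} {v} = trans (adj-sym G v u)

  Adj-irrefl : ∀ {v} → ¬ Adj G v v
  Adj-irrefl {v} a with trans (sym (irrefl G v)) a
  ... | ()

  ∈N⇒Adj : ∀ {u v} → v ∈ N G u → Adj G u v
  ∈N⇒Adj {u} = ∈-tabulate⁻ (adj G u)

  degree≤maxDegree : ∀ v → degree G v ≤ maxDegree G
  degree≤maxDegree v = x∈xs⇒x≤foldr⊔ (∈-map⁺ (degree G) (∈-allFin v))

  Chain-take : ∀ k xs → Chain G xs → Chain G (take k xs)
  Chain-take zero          xs           _        = tt
  Chain-take (suc k)       []           _        = tt
  Chain-take (suc zero)    (x ∷ xs)     _        = tt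
  Chain-take (suc (suc k)) (x ∷ [])     _        = tt
  Chain-take (suc (suc k)) (x ∷ y ∷ xs) (a , ch) = a , Chain-take (suc k) (y ∷ xs) ch

  lastOf-take : ∀ x {xs v} (v∈xs : v ∈ₗ xs) → lastOf G x (take (suc (toℕ (index v∈xs))) xs) ≡ v
  lastOf-take x         (here refl)  = refl
  lastOf-take x {y ∷ _} (there v∈xs) = lastOf-take y v∈xs

  chord⇒HasCycle : ∀ {x f rest v} → Unique (x ∷ f ∷ rest) → Chain G (x ∷ f ∷ rest) →
                   v ∈ₗ rest → Adj G x v → HasCycle G
  chord⇒HasCycle {x} {f} {r ∷ rest} unique chain v∈rest x~v =
    x , f ∷ take (suc i) (r ∷ rest) , take⁺ (3 + i) unique , s≤s (s≤s z≤n) ,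
    Chain-take (3 + i) _ chain ,
    subst (λ y → Adj G y x) (sym (lastOf-take f v∈rest)) (Adj-sym x~v)
    where
    i = toℕ (index v∈rest)

  module _ (R : Fin n → Fin n → Set)
           (continue : ∀ {v u} → R v u → ∃ λ w → Adj G v w × w ≢ u × R w v) where

    private
      walk : ∀ fuel {cur prev} rest → n < fuel + length (cur ∷ prev ∷ rest) →
             Unique (cur ∷ prev ∷ rest) → Chain G (cur ∷ prev ∷ rest) → R cur prev → HasCycle G
      walk zero rest long unique _ _ = contradiction (length≤-Unique unique) (<⇒≱ long)
      walk (suc fuel) {cur} {prev} rest long unique chain r with continue r
      ... | w , cur~w , w≢prev , r′ with Any.any? (w ≟_) (cur ∷ prev ∷ rest)
      ...   | yes (here refl)         = contradiction cur~w Adj-irrefl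
      ...   | yes (there (here refl)) = contradiction refl w≢prev
      ...   | yes (there (there w∈))  = chord⇒HasCycle unique chain w∈ cur~w
      ...   | no w∉ = walk fuel (prev ∷ rest)
                        (subst (n <_) (sym (+-suc fuel (length (cur ∷ prev ∷ rest)))) long)
                        (¬Any⇒All¬ _ w∉ ∷ unique) (Adj-sym cur~w , chain) r′

    nonBacktracking⇒HasCycle : ∀ {v u} → R v u → HasCycle G
    nonBacktracking⇒HasCycle r with continue r
    ... | w , v~w , _ , r′ =
      walk n [] (m<m+n n (s≤s z≤n)) (((λ { refl → Adj-irrefl v~w }) ∷ []) ∷ [] ∷ [])
           (Adj-sym v~w , tt) r′

  Earlier : (Fin n → ℕ) → Fin n → Subset n
  Earlier t v = tabulate (λ x → t x <ᵇ t v)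

  ∈-Earlier⁺ : ∀ t {x v} → t x < t v → x ∈ Earlier t v
  ∈-Earlier⁺ t {v = v} lt =
    ∈-tabulate⁺ (λ x → t x <ᵇ t v) (Equivalence.to T-≡ (<⇒<ᵇ lt))

  ∈-Earlier⁻ : ∀ t {x v} → x ∈ Earlier t v → t x < t v
  ∈-Earlier⁻ t {x} {v} x∈ =
    <ᵇ⇒< (t x) (t v) (Equivalence.from T-≡ (∈-tabulate⁻ (λ x → t x <ᵇ t v) x∈))

  -- t v is the round in which v turns blue.
  Schedule : ℕ → Subset n → (Fin n → ℕ) → Set
  Schedule p B t = ∀ v → v ∉ B → p ≤ ∣ N G v ∩ Earlier t v ∣

  Schedule-mono : ∀ {p B B′ t} → B ⊆ B′ → Schedule p B t → Schedule p B′ t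
  Schedule-mono B⊆B′ sched v v∉B′ = sched v (v∉B′ ∘ B⊆B′)

  postpone : Subset n → (Fin n → ℕ) → Fin n → ℕ
  postpone B t v with v ∈? B
  ... | yes _ = 0
  ... | no  _ = suc (t v)

  postpone-∈ : ∀ {B} t {v} → v ∈ B → postpone B t v ≡ 0
  postpone-∈ {B} t {v} v∈B with v ∈? B
  ... | yes _   = refl
  ... | no  v∉B = contradiction v∈B v∉B

  postpone-∉ : ∀ {B} t {v} → v ∉ B → postpone B t v ≡ suc (t v)
  postpone-∉ {B} t {v} v∉B with v ∈? B
  ... | yes v∈B = contradiction v∈B v∉B
  ... | no  _   = refl

  postpone-≤ : ∀ B t v → postpone B t v ≤ suc (t v)
  postpone-≤ B t v with v ∈? B
  ... | yes _ = z≤n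
  ... | no  _ = ≤-refl

  spreading⇒Schedule : ∀ {p q B} → Star (Step G p q) B full → ∃ (Schedule p B)
  spreading⇒Schedule ε = (λ _ → 0) , λ _ v∉full → contradiction ∈⊤ v∉full
  spreading⇒Schedule {p} {B = B} ((w , w∉B , p≤ , _ , refl) ◅ steps)
    with spreading⇒Schedule steps
  ... | t , sched = postpone B t , sched′
    where
    sched′ : Schedule p B (postpone B t)
    sched′ v v∉B with v ≟ w
    ... | yes refl =
      ≤-trans p≤ (∣∩∣-monoʳ (N G v) λ _ x∈B → ∈-Earlier⁺ (postpone B t) (blue-before-v x∈B))
      where
      blue-before-v : ∀ {x} → x ∈ B → postpone B t x < postpone B t v
      blue-before-v x∈B rewrite postpone-∈ t x∈B | postpone-∉ t v∉B = s≤s z≤n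
    ... | no v≢w = ≤-trans (sched v v∉B∪⁅w⁆) (∣∩∣-monoʳ (N G v) λ _ x∈E →
                     ∈-Earlier⁺ (postpone B t) (stays-earlier (∈-Earlier⁻ t x∈E)))
      where
      v∉B∪⁅w⁆ : v ∉ B ∪ ⁅ w ⁆
      v∉B∪⁅w⁆ v∈ with x∈p∪q⁻ B ⁅ w ⁆ v∈
      ... | inj₁ v∈B  = v∉B v∈B
      ... | inj₂ v∈⁅w⁆ = v≢w (x∈⁅y⁆⇒x≡y w v∈⁅w⁆)
      stays-earlier : ∀ {x} → t x < t v → postpone B t x < postpone B t v
      stays-earlier {x} lt rewrite postpone-∉ t v∉B = s≤s (≤-trans (postpone-≤ B t x) lt)

  Eligible : ℕ → Maybe ℕ → Subset n → Fin n → Set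
  Eligible p q B w = w ∉ B × p ≤ ∣ N G w ∩ B ∣ ×
    Σ (Fin n) λ u → u ∈ B × Adj G w u × WithinQ G q ∣ N G u ∩ ∁ B ∣

  withinQ? : ∀ q k → Dec (WithinQ G q k)
  withinQ? nothing  _ = yes tt
  withinQ? (just q) k = k ≤? q

  eligible? : ∀ p q B w → Dec (Eligible p q B w)
  eligible? p q B w =
    ¬? (w ∈? B) ×-dec (p ≤? ∣ N G w ∩ B ∣) ×-dec
    Fin.any? (λ u → u ∈? B ×-dec (adj G w u ≟ᵇ true) ×-dec withinQ? q ∣ N G u ∩ ∁ B ∣)

  Eligible⇒Step : ∀ {p q B w} → Eligible p q B w → Step G p q B (B ∪ ⁅ w ⁆)
  Eligible⇒Step {w = w} (w∉B , p≤ , blue) = w , w∉B , p≤ , blue , refl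

  Spreading-weaken : ∀ {p q q′} →
    (∀ u B → WithinQ G q ∣ N G u ∩ ∁ B ∣ → WithinQ G q′ ∣ N G u ∩ ∁ B ∣) →
    ∀ {S} → Spreading G p q S → Spreading G p q′ S
  Spreading-weaken weaken = Star.map λ where
    (w , w∉B , p≤ , (u , u∈B , w~u , within) , refl) →
      w , w∉B , p≤ , (u , u∈B , w~u , weaken u _ within) , refl

  sameSpreadingSets⇒IsSigma⇔ : ∀ {p q q′} →
    (∀ {S} → Spreading G p q S → Spreading G p q′ S) →
    (∀ {S} → Spreading G p q′ S → Spreading G p q S) →
    ∀ k → IsSigma G p q k ⇔ IsSigma G p q′ k
  sameSpreadingSets⇒IsSigma⇔ to from k = mk⇔
    (λ ((S , spreads , size) , minimal) → (S , to spreads , size) , λ S′ → minimal S′ ∘ from)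
    (λ ((S , spreads , size) , minimal) → (S , from spreads , size) , λ S′ → minimal S′ ∘ to)

  module Stuck {p} (2≤p : 2 ≤ p) {B t} (sched : Schedule p B t)
               (stuck : ∀ w → ¬ Eligible p (just 1) B w) where

    -- Visit v u: the walk is at v, coming from u.  A white vertex must not be entered from an
    -- earlier white one, so that moving on to an earlier white neighbour never backtracks.
    data Visit : Fin n → Fin n → Set where
      white : ∀ {v u} → v ∉ B → ¬ (u ∉ B × t u < t v) → Visit v u
      blue  : ∀ {v u} → v ∈ B → 2 ≤ ∣ N G v ∩ ∁ B ∣ → Visit v u

    blue-next-to-ready : ∀ {w y} → w ∉ B → p ≤ ∣ N G w ∩ B ∣ → y ∈ B → Adj G w y →
                         2 ≤ ∣ N G y ∩ ∁ B ∣
    blue-next-to-ready w∉B p≤ y∈B w~y = ≰⇒> λ ≤1 → stuck _ (w∉B , p≤ , _ , y∈B , w~y , ≤1)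

    continue : ∀ {v u} → Visit v u → ∃ λ w → Adj G v w × w ≢ u × Visit w v
    continue {v} {u} (blue v∈B 2≤white) with 2≤∣A∣⇒∃∈≢ 2≤white u
    ... | y , y∈ , y≢u with x∈p∩q⁻ (N G v) (∁ B) y∈
    ...   | y∈N , y∈∁B = y , ∈N⇒Adj y∈N , y≢u , white (x∈∁p⇒x∉p y∈∁B) λ (v∉B , _) → v∉B v∈B
    continue {v} {u} (white v∉B ¬from-earlier-white)
      with Fin.any? (λ y → y ∈? (N G v ∩ Earlier t v) ×-dec ¬? (y ∈? B))
    ... | yes (y , y∈ , y∉B) with x∈p∩q⁻ (N G v) (Earlier t v) y∈
    ...   | y∈N , y∈E =
      y , ∈N⇒Adj y∈N , (λ { refl → ¬from-earlier-white (y∉B , ∈-Earlier⁻ t y∈E) }) ,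
      white y∉B λ (_ , tv<ty) → <-asym tv<ty (∈-Earlier⁻ t y∈E)
    continue {v} {u} (white v∉B _) | no none
      with 2≤∣A∣⇒∃∈≢ (≤-trans 2≤p (sched v v∉B)) u
    ... | y , y∈ , y≢u with x∈p∩q⁻ (N G v) (Earlier t v) y∈
    ...   | y∈N , _ = y , ∈N⇒Adj y∈N , y≢u , blue y∈B
                        (blue-next-to-ready v∉B p≤blue y∈B (∈N⇒Adj y∈N))
      where
      earlier⇒blue : ∀ {x} → x ∈ N G v ∩ Earlier t v → x ∈ B
      earlier⇒blue {x} x∈ with x ∈? B
      ... | yes x∈B = x∈B
      ... | no  x∉B = contradiction (x , x∈ , x∉B) none
      y∈B : y ∈ B
      y∈B = earlier⇒blue y∈
      p≤blue : p ≤ ∣ N G v ∩ B ∣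
      p≤blue = ≤-trans (sched v v∉B)
                       (∣∩∣-monoʳ (N G v) λ x∈N x∈E → earlier⇒blue (x∈p∩q⁺ (x∈N , x∈E)))

    stuck⇒full : ¬ HasCycle G → B ≡ full
    stuck⇒full acyclic = ⊆-antisym ⊆⊤ λ {x} _ → blue-at x
      where
      blue-at : ∀ x → x ∈ B
      blue-at x with x ∈? B
      ... | yes x∈B = x∈B
      ... | no  x∉B = contradiction
        (nonBacktracking⇒HasCycle Visit continue (white {u = x} x∉B λ (_ , lt) → <-irrefl refl lt))
        acyclic

  Schedule⇒spreading₁ : ∀ {p B t} → ¬ HasCycle G → 2 ≤ p → Schedule p B t →
                        Spreading G p (just 1) B
  Schedule⇒spreading₁ {p} {B} {t} acyclic 2≤p = greedy B (⊃-wellFounded B)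
    where
    greedy : ∀ B → Acc _⊃_ B → Schedule p B t → Star (Step G p (just 1)) B full
    greedy B (acc larger) sched with Fin.any? (eligible? p (just 1) B)
    ... | yes (w , eligible@(w∉B , _)) =
      Eligible⇒Step eligible ◅
        greedy (B ∪ ⁅ w ⁆) (larger (B⊂B∪⁅x⁆ w∉B)) (Schedule-mono {t = t} (p⊆p∪q ⁅ w ⁆) sched)
    ... | no stuck =
      subst (λ X → Star (Step G p (just 1)) X full)
            (sym (Stuck.stuck⇒full 2≤p {t = t} sched (λ w e → stuck (w , e)) acyclic)) ε

  forest-spreading⇒spreading₁ : ∀ {p q S} → ¬ HasCycle G → 2 ≤ p →
                                 Spreading G p q S → Spreading G p (just 1) S
  forest-spreading⇒spreading₁ acyclic 2≤p spreads =
    let t , sched = spreading⇒Schedule spreads in Schedule⇒spreading₁ {t = t} acyclic 2≤p sched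

theorem4p3 : ∀ {n} (T : Graph n) → IsTree T → (p : ℕ) → 2 ≤ p →
    ((q : ℕ) → 1 ≤ q → ∀ k → IsSigma T p (just q) k ⇔ IsSigma T p (just 1) k)
    × (∀ k → IsSigma T p nothing k ⇔ IsSigma T p (just 1) k)
    × (∀ k → IsSigma T p nothing k ⇔ IsSigma T p (just (maxDegree T)) k)
theorem4p3 T (_ , _ , acyclic) p 2≤p =
    (λ q 1≤q → sameSpreadingSets⇒IsSigma⇔ T to₁ (Spreading-weaken T λ _ _ ≤1 → ≤-trans ≤1 1≤q))
  , sameSpreadingSets⇒IsSigma⇔ T to₁ to∞
  , sameSpreadingSets⇒IsSigma⇔ T toΔ to∞
  where
  to₁ : ∀ {q S} → Spreading T p q S → Spreading T p (just 1) S
  to₁ = forest-spreading⇒spreading₁ T acyclic 2≤p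
  to∞ : ∀ {q S} → Spreading T p q S → Spreading T p nothing S
  to∞ = Spreading-weaken T λ _ _ _ → tt
  toΔ : ∀ {q S} → Spreading T p q S → Spreading T p (just (maxDegree T)) S
  toΔ = Spreading-weaken T λ u B _ → ≤-trans (∣p∩q∣≤∣p∣ (N T u) (∁ B)) (degree≤maxDegree T u)
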